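{- Let $S_1$ and $S_2$ be two finite multisets of positive integers and let $\gamma>0$ be such that $|S_1|>\gamma|S_2|$ (cardinalities counted with multiplicity). Then there exists an integer $j$ such that $$\sum_{i\in S_1,\ i\ge j}\frac1i>\gamma\sum_{i\in S_2,\ i\ge j}\frac1i,$$ where the sums are over elements of the multisets counted with multiplicity.
   Formalization: The parameter γ ranges over the positive rationals. -}

module Defs where

open import Data.Nat as ℕ using (ℕ; zero; suc)
open import Data.Integer as ℤ using (ℤ; +_)
open import Data.Rational using (ℚ; 0ℚ; _+_; _/_)
open import Data.List using (List; []; _∷_)
open import Relation.Nullary using (yes; no)

-- Reciprocal 1/i of a natural number as a rational.
-- (Only applied to positive i in the statement; the value at 0 is an
-- irrelevant convention.)
recip : ℕ → ℚ
recip zero    = 0ℚ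
recip (suc n) = (+ 1) / suc n

-- A finite multiset of naturals is represented by a list (order irrelevant,
-- multiplicity = number of occurrences).
-- tailSum j S = ∑_{i ∈ S, i ≥ j} 1/i, counted with multiplicity.
tailSum : ℤ → List ℕ → ℚ
tailSum j []      = 0ℚ
tailSum j (i ∷ S) with j ℤ.≤? + i
... | yes _ = recip i + tailSum j S
... | no  _ = tailSum j S

-- Sum the tails over all thresholds j = 1, …, N, with N an upper bound of both
-- multisets: an element i ≤ N lies in exactly i of the tails and contributes
-- 1/i to each, so ∑ⱼ tailSum j S = |S|.  Hence
-- ∑ⱼ γ · tailSum j S₂ = γ |S₂| < |S₁| = ∑ⱼ tailSum j S₁, and some term of the
-- left sum is smaller than the corresponding term of the right one.
module Submission where

open import Defs
open import Data.Nat as ℕ using (ℕ; zero; suc; s≤s)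
open import Data.Nat.Properties as ℕ using (≤-totalOrder)
open import Data.Integer as ℤ using (+_; +≤+)
open import Data.Integer.Tactic.RingSolver using (solve-∀)
open import Data.Rational using (ℚ; 0ℚ; 1ℚ; _+_; _*_; _/_; _<_; toℚᵘ)
open import Data.Rational.Properties
import Data.Rational.Unnormalised as ℚᵘ
import Data.Rational.Unnormalised.Properties as ℚᵘ
open import Data.List using (List; []; _∷_; [_]; _++_; length)
open import Data.List.Extrema ≤-totalOrder using (max; xs≤max)
open import Data.List.Relation.Unary.All using (All; _∷_)
open import Data.List.Relation.Unary.All.Properties using (++⁻)
open import Data.Product using (∃-syntax; _×_; _,_; proj₁; proj₂)
open import Data.Sum using (inj₁; inj₂)
open import Relation.Nullary using (yes; no; ¬_)
open import Relation.Nullary.Negation using (contradiction)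
open import Relation.Binary.PropositionalEquality hiding ([_])
open import Algebra.Bundles using (CommutativeMonoid)
open import Algebra.Properties.CommutativeSemigroup
  (CommutativeMonoid.commutativeSemigroup +-0-commutativeMonoid) using (interchange)

fromℕ : ℕ → ℚ
fromℕ n = + n / 1

toℚᵘ-fromℕ : ∀ n → toℚᵘ (fromℕ n) ℚᵘ.≃ ℚᵘ.mkℚᵘ (+ n) 0
toℚᵘ-fromℕ n = toℚᵘ-fromℚᵘ (ℚᵘ.mkℚᵘ (+ n) 0)

fromℕ-suc : ∀ n → fromℕ (suc n) ≡ fromℕ n + 1ℚ
fromℕ-suc n = toℚᵘ-injective (begin
  toℚᵘ (fromℕ (suc n))               ≈⟨ toℚᵘ-fromℕ (suc n) ⟩
  ℚᵘ.mkℚᵘ (+ suc n) 0                ≈⟨ ℚᵘ.*≡* (cross-multiplied (+ n)) ⟩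
  ℚᵘ.mkℚᵘ (+ n) 0 ℚᵘ.+ ℚᵘ.1ℚᵘ        ≈⟨ ℚᵘ.+-cong (toℚᵘ-fromℕ n) ℚᵘ.≃-refl ⟨
  toℚᵘ (fromℕ n) ℚᵘ.+ toℚᵘ 1ℚ        ≈⟨ toℚᵘ-homo-+ (fromℕ n) 1ℚ ⟨
  toℚᵘ (fromℕ n + 1ℚ)                ∎)
  where
  open ℚᵘ.≃-Reasoning
  cross-multiplied : ∀ x → (+ 1 ℤ.+ x) ℤ.* + 1 ≡ (x ℤ.* + 1 ℤ.+ + 1 ℤ.* + 1) ℤ.* + 1
  cross-multiplied = solve-∀

fromℕ*recip : ∀ n → fromℕ (suc n) * recip (suc n) ≡ 1ℚ
fromℕ*recip n = toℚᵘ-injective (begin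
  toℚᵘ (fromℕ (suc n) * recip (suc n))                ≈⟨ toℚᵘ-homo-* (fromℕ (suc n)) (recip (suc n)) ⟩
  toℚᵘ (fromℕ (suc n)) ℚᵘ.* toℚᵘ (recip (suc n))      ≈⟨ ℚᵘ.*-cong (toℚᵘ-fromℕ (suc n)) (toℚᵘ-fromℚᵘ (ℚᵘ.mkℚᵘ (+ 1) n)) ⟩
  ℚᵘ.mkℚᵘ (+ suc n) 0 ℚᵘ.* ℚᵘ.mkℚᵘ (+ 1) n            ≈⟨ ℚᵘ.*-inverseʳ (ℚᵘ.mkℚᵘ (+ suc n) 0) ⟩
  ℚᵘ.1ℚᵘ                                              ∎)
  where open ℚᵘ.≃-Reasoning

∑₁ : ℕ → (ℕ → ℚ) → ℚ
∑₁ zero    f = 0ℚ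
∑₁ (suc N) f = ∑₁ N f + f (suc N)

∑₁-cong : ∀ N {f g : ℕ → ℚ} → (∀ j → f j ≡ g j) → ∑₁ N f ≡ ∑₁ N g
∑₁-cong zero    f≡g = refl
∑₁-cong (suc N) f≡g = cong₂ _+_ (∑₁-cong N f≡g) (f≡g (suc N))

∑₁-0 : ∀ N → ∑₁ N (λ _ → 0ℚ) ≡ 0ℚ
∑₁-0 zero    = refl
∑₁-0 (suc N) = trans (+-identityʳ (∑₁ N (λ _ → 0ℚ))) (∑₁-0 N)

∑₁-distrib-+ : ∀ N (f g : ℕ → ℚ) → ∑₁ N (λ j → f j + g j) ≡ ∑₁ N f + ∑₁ N g
∑₁-distrib-+ zero    f g = refl
∑₁-distrib-+ (suc N) f g =
  trans (cong (_+ (f (suc N) + g (suc N))) (∑₁-distrib-+ N f g))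
        (interchange (∑₁ N f) (∑₁ N g) (f (suc N)) (g (suc N)))

*-distribˡ-∑₁ : ∀ N c (f : ℕ → ℚ) → c * ∑₁ N f ≡ ∑₁ N (λ j → c * f j)
*-distribˡ-∑₁ zero    c f = *-zeroʳ c
*-distribˡ-∑₁ (suc N) c f =
  trans (*-distribˡ-+ c (∑₁ N f) (f (suc N))) (cong (_+ c * f (suc N)) (*-distribˡ-∑₁ N c f))

∑₁-<⇒< : ∀ N (f g : ℕ → ℚ) → ∑₁ N f < ∑₁ N g → ∃[ j ] f j < g j
∑₁-<⇒< zero    f g 0<0 = contradiction 0<0 (<-irrefl refl)
∑₁-<⇒< (suc N) f g ∑f<∑g with f (suc N) <? g (suc N)
... | yes fN<gN = suc N , fN<gN
... | no  fN≮gN = ∑₁-<⇒< N f g (≰⇒> λ ∑g≤∑f →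
  <-irrefl refl (<-≤-trans ∑f<∑g (+-mono-≤ ∑g≤∑f (≮⇒≥ fN≮gN))))

tailSum-∷ : ∀ j i S → tailSum j (i ∷ S) ≡ tailSum j [ i ] + tailSum j S
tailSum-∷ j i S with j ℤ.≤? + i
... | yes _ = cong (_+ tailSum j S) (sym (+-identityʳ (recip i)))
... | no  _ = sym (+-identityˡ (tailSum j S))

tailSum-singleton-≤ : ∀ {j i} → j ℤ.≤ + i → tailSum j [ i ] ≡ recip i
tailSum-singleton-≤ {j} {i} j≤i with j ℤ.≤? + i
... | yes _   = +-identityʳ (recip i)
... | no  j≰i = contradiction j≤i j≰i

tailSum-singleton-> : ∀ {j i} → ¬ j ℤ.≤ + i → tailSum j [ i ] ≡ 0ℚ
tailSum-singleton-> {j} {i} j≰i with j ℤ.≤? + i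
... | yes j≤i = contradiction j≤i j≰i
... | no  _   = refl

∑₁-tailSum-singleton-below : ∀ N k → N ℕ.≤ suc k →
                             ∑₁ N (λ j → tailSum (+ j) [ suc k ]) ≡ fromℕ N * recip (suc k)
∑₁-tailSum-singleton-below zero    k _   = sym (*-zeroˡ (recip (suc k)))
∑₁-tailSum-singleton-below (suc N) k N<1+k = begin
  ∑₁ N (λ j → tailSum (+ j) [ suc k ]) + tailSum (+ suc N) [ suc k ]
    ≡⟨ cong₂ _+_ (∑₁-tailSum-singleton-below N k (ℕ.<⇒≤ N<1+k)) (tailSum-singleton-≤ (+≤+ N<1+k)) ⟩
  fromℕ N * recip (suc k) + recip (suc k)
    ≡⟨ cong (λ x → fromℕ N * recip (suc k) + x) (*-identityˡ (recip (suc k))) ⟨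
  fromℕ N * recip (suc k) + 1ℚ * recip (suc k)
    ≡⟨ *-distribʳ-+ (recip (suc k)) (fromℕ N) 1ℚ ⟨
  (fromℕ N + 1ℚ) * recip (suc k)
    ≡⟨ cong (_* recip (suc k)) (fromℕ-suc N) ⟨
  fromℕ (suc N) * recip (suc k) ∎
  where open ≡-Reasoning

∑₁-tailSum-singleton : ∀ N k → suc k ℕ.≤ N → ∑₁ N (λ j → tailSum (+ j) [ suc k ]) ≡ 1ℚ
∑₁-tailSum-singleton (suc N) k k<1+N with ℕ.m≤n⇒m<n∨m≡n k<1+N
... | inj₂ refl       = trans (∑₁-tailSum-singleton-below (suc k) k ℕ.≤-refl) (fromℕ*recip k)
... | inj₁ (s≤s k<N) = begin
  ∑₁ N (λ j → tailSum (+ j) [ suc k ]) + tailSum (+ suc N) [ suc k ]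
    ≡⟨ cong₂ _+_ (∑₁-tailSum-singleton N k k<N) (tailSum-singleton-> 1+N≰1+k) ⟩
  1ℚ + 0ℚ
    ≡⟨ +-identityʳ 1ℚ ⟩
  1ℚ ∎
  where
  open ≡-Reasoning
  1+N≰1+k : ¬ + suc N ℤ.≤ + suc k
  1+N≰1+k (+≤+ (s≤s N≤k)) = ℕ.<⇒≱ k<N N≤k

∑₁-tailSum : ∀ N S → All (0 ℕ.<_) S → All (ℕ._≤ N) S →
             ∑₁ N (λ j → tailSum (+ j) S) ≡ fromℕ (length S)
∑₁-tailSum N []          _         _           = ∑₁-0 N
∑₁-tailSum N (suc k ∷ S) (_ ∷ S>0) (k<N ∷ S≤N) = begin
  ∑₁ N (λ j → tailSum (+ j) (suc k ∷ S))
    ≡⟨ ∑₁-cong N (λ j → tailSum-∷ (+ j) (suc k) S) ⟩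
  ∑₁ N (λ j → tailSum (+ j) [ suc k ] + tailSum (+ j) S)
    ≡⟨ ∑₁-distrib-+ N _ _ ⟩
  ∑₁ N (λ j → tailSum (+ j) [ suc k ]) + ∑₁ N (λ j → tailSum (+ j) S)
    ≡⟨ cong₂ _+_ (∑₁-tailSum-singleton N k k<N) (∑₁-tailSum N S S>0 S≤N) ⟩
  1ℚ + fromℕ (length S)
    ≡⟨ +-comm 1ℚ (fromℕ (length S)) ⟩
  fromℕ (length S) + 1ℚ
    ≡⟨ fromℕ-suc (length S) ⟨
  fromℕ (length (suc k ∷ S)) ∎
  where open ≡-Reasoning

lemma2p8 : (S₁ S₂ : List ℕ) → All (ℕ._<_ 0) S₁ → All (ℕ._<_ 0) S₂ →
           (γ : ℚ) → 0ℚ < γ →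
           γ * ((+ length S₂) / 1) < ((+ length S₁) / 1) →
           ∃[ j ] (γ * tailSum j S₂ < tailSum j S₁)
lemma2p8 S₁ S₂ S₁>0 S₂>0 γ _ γ|S₂|<|S₁| =
  let j , γtail₂<tail₁ = ∑₁-<⇒< N (λ j → γ * tailSum (+ j) S₂) (λ j → tailSum (+ j) S₁) ∑γtail₂<∑tail₁
  in + j , γtail₂<tail₁
  where
  N : ℕ
  N = max 0 (S₁ ++ S₂)
  bounds : All (ℕ._≤ N) S₁ × All (ℕ._≤ N) S₂
  bounds = ++⁻ S₁ (xs≤max 0 (S₁ ++ S₂))
  ∑γtail₂<∑tail₁ : ∑₁ N (λ j → γ * tailSum (+ j) S₂) < ∑₁ N (λ j → tailSum (+ j) S₁)
  ∑γtail₂<∑tail₁ = begin-strict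
    ∑₁ N (λ j → γ * tailSum (+ j) S₂)    ≡⟨ *-distribˡ-∑₁ N γ (λ j → tailSum (+ j) S₂) ⟨
    γ * ∑₁ N (λ j → tailSum (+ j) S₂)    ≡⟨ cong (γ *_) (∑₁-tailSum N S₂ S₂>0 (proj₂ bounds)) ⟩
    γ * fromℕ (length S₂)                <⟨ γ|S₂|<|S₁| ⟩
    fromℕ (length S₁)                    ≡⟨ ∑₁-tailSum N S₁ S₁>0 (proj₁ bounds) ⟨
    ∑₁ N (λ j → tailSum (+ j) S₁)        ∎
    where open ≤-Reasoning
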